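{- Let $s$ be a term (in $L$ expanded by division) that does not contain the variable $x$. Then for all integers $n\ge1$ and $i\ge0$ there is a finite sequence of formulas $\theta_0,\dots,\theta_{m-1}$, each of the form $D_n(2^ws)\wedge D_n(2^rx)$ for some integers $0\le w,r<n$, such that $T\vdash A(x)\to\Big(D_n(s\,x^i)\leftrightarrow\bigvee_{k<m}\theta_k\Big)$.
   Context: Let $L$ be the language with constant symbols $0,1$, binary function symbols $+,-,\times$, the binary relation $<$, a unary function symbol $\lambda$, a unary predicate $A$, and unary predicates $D_n$ for each integer $n\ge 1$. Let $T$ be the $L$-theory consisting of the axioms of real closed ordered fields together with: $\forall x(A(x)\to x>0)$; $\forall x,y(A(x)\to(A(y)\leftrightarrow A(xy)))$; $A(2)\wedge\forall x(1<x<2\to\neg A(x))$; $\forall x(x>0\to\exists y(A(y)\wedge y\le x<2y))$; for each $n\ge1$, $\forall x(D_n(x)\leftrightarrow\exists y(A(y)\wedge y^n=x))$; $\forall x(x\le 0\to\lambda(x)=0)$; $\forall x(x>0\to A(\lambda(x))\wedge\lambda(x)\le x<2\lambda(x))$. Here $2$ abbreviates $1+1$ and $2^r$ ($r\ge0$) the corresponding numeral. The division symbol $/$ is a binary function symbol defined in $T$ by $x/y=z\leftrightarrow((y\neq0\wedge x=yz)\vee(y=0\wedge z=0))$. -}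

module Defs where

open import Data.Nat using (ℕ; zero; suc) renaming (_≤_ to _≤ℕ_)
open import Data.Fin using (Fin; toℕ)
open import Data.Vec using (Vec; []; _∷_)
open import Data.List using (List)
open import Data.List.Relation.Unary.Any using (Any)
open import Data.Product using (Σ; ∃; _×_; _,_)
open import Data.Sum using (_⊎_)
open import Relation.Nullary using (¬_)
open import Relation.Binary.PropositionalEquality using (_≡_; _≢_)
open import Function.Bundles using (_⇔_)

-- Models of the L-theory T, expanded by the defined division symbol.
-- (Semantic rendering of T ⊢ φ : φ holds in every model of T.)

record LStructure : Set₁ where
  infixl 6 _+_ _-_
  infixl 7 _*_ _/_
  infix 4 _<_
  field
    Carrier : Set
    0# 1#   : Carrier
    _+_ _-_ _*_ : Carrier → Carrier → Carrier
    _<_     : Carrier → Carrier → Set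
    lam     : Carrier → Carrier
    A       : Carrier → Set
    D       : ℕ → Carrier → Set        -- D n ; only n ≥ 1 is meaningful
    _/_     : Carrier → Carrier → Carrier

module Ops (S : LStructure) where
  open LStructure S
  infix 4 _≤ᶠ_
  _≤ᶠ_ : Carrier → Carrier → Set
  x ≤ᶠ y = x < y ⊎ x ≡ y

  2# : Carrier
  2# = 1# + 1#

  pow : Carrier → ℕ → Carrier
  pow x zero    = 1#
  pow x (suc k) = x * pow x k

  -- Horner evaluation of the monic polynomial X^(d) + a_{d-1} X^{d-1} + ... + a_0,
  -- coefficients listed from a_{d-1} down to a_0.
  evalMonic : ∀ {d} → Vec Carrier d → Carrier → Carrier
  evalMonic {d} as y = go as (pow y d)
    where
    go : ∀ {k} → Vec Carrier k → Carrier → Carrier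
    go [] acc = acc
    go {suc k} (a ∷ as) acc = go as (acc + a * pow y k)

record IsModelT (S : LStructure) : Set where
  open LStructure S
  open Ops S
  field
    +-assoc  : ∀ x y z → (x + y) + z ≡ x + (y + z)
    +-comm   : ∀ x y → x + y ≡ y + x
    +-idʳ    : ∀ x → x + 0# ≡ x
    -‿def    : ∀ x y → (x - y) + y ≡ x
    *-assoc  : ∀ x y z → (x * y) * z ≡ x * (y * z)
    *-comm   : ∀ x y → x * y ≡ y * x
    *-idʳ    : ∀ x → x * 1# ≡ x
    distrib  : ∀ x y z → x * (y + z) ≡ x * y + x * z
    0≢1      : 0# ≢ 1#
    inverse  : ∀ x → x ≢ 0# → ∃ λ y → x * y ≡ 1#
    <-irrefl : ∀ x → ¬ (x < x)
    <-trans  : ∀ x y z → x < y → y < z → x < z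
    <-tri    : ∀ x y → x < y ⊎ x ≡ y ⊎ y < x
    <-+      : ∀ x y z → x < y → x + z < y + z
    <-*      : ∀ x y → 0# < x → 0# < y → 0# < x * y
    sqrt     : ∀ x → 0# < x → ∃ λ y → y * y ≡ x
    oddRoot  : ∀ k (as : Vec Carrier (suc (k Data.Nat.* 2))) →
               ∃ λ y → evalMonic as y ≡ 0#
    A-pos    : ∀ x → A x → 0# < x
    A-mul    : ∀ x y → A x → (A y ⇔ A (x * y))
    A-2      : A 2#
    A-gap    : ∀ x → 1# < x → x < 2# → ¬ A x
    A-dense  : ∀ x → 0# < x → ∃ λ y → A y × y ≤ᶠ x × x < 2# * y
    D-def    : ∀ n → 1 ≤ℕ n → ∀ x → (D n x ⇔ ∃ λ y → A y × pow y n ≡ x)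
    lam-np   : ∀ x → x ≤ᶠ 0# → lam x ≡ 0#
    lam-pos  : ∀ x → 0# < x → A (lam x) × lam x ≤ᶠ x × x < 2# * lam x
    /-def    : ∀ x y z → (x / y ≡ z ⇔ ((y ≢ 0# × x ≡ y * z) ⊎ (y ≡ 0# × z ≡ 0#)))

open LStructure public
open Ops public
open IsModelT public

record ModelT : Set₁ where
  field
    struct : LStructure
    isT    : IsModelT struct

open ModelT public

data Term : Set where
  var  : ℕ → Term
  zer one : Term
  _⊕_ _⊖_ _⊗_ _⊘_ : Term → Term → Term
  lamT : Term → Term

data _∉ₜ_ (x : ℕ) : Term → Set where
  var  : ∀ {y} → x ≢ y → x ∉ₜ var y
  zer  : x ∉ₜ zer
  one  : x ∉ₜ one
  _⊕_  : ∀ {s t} → x ∉ₜ s → x ∉ₜ t → x ∉ₜ (s ⊕ t)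
  _⊖_  : ∀ {s t} → x ∉ₜ s → x ∉ₜ t → x ∉ₜ (s ⊖ t)
  _⊗_  : ∀ {s t} → x ∉ₜ s → x ∉ₜ t → x ∉ₜ (s ⊗ t)
  _⊘_  : ∀ {s t} → x ∉ₜ s → x ∉ₜ t → x ∉ₜ (s ⊘ t)
  lamT : ∀ {s} → x ∉ₜ s → x ∉ₜ lamT s

⟦_⟧ : Term → (S : LStructure) → (ℕ → Carrier S) → Carrier S
⟦ var v ⟧ S ρ = ρ v
⟦ zer ⟧ S ρ = 0# S
⟦ one ⟧ S ρ = 1# S
⟦ s ⊕ t ⟧ S ρ = _+_ S (⟦ s ⟧ S ρ) (⟦ t ⟧ S ρ)
⟦ s ⊖ t ⟧ S ρ = _-_ S (⟦ s ⟧ S ρ) (⟦ t ⟧ S ρ)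
⟦ s ⊗ t ⟧ S ρ = _*_ S (⟦ s ⟧ S ρ) (⟦ t ⟧ S ρ)
⟦ s ⊘ t ⟧ S ρ = _/_ S (⟦ s ⟧ S ρ) (⟦ t ⟧ S ρ)
⟦ lamT s ⟧ S ρ = lam S (⟦ s ⟧ S ρ)

-- the formula θ = D_n(2^w s) ∧ D_n(2^r x), coded by (w , r) with w , r < n
θ-holds : (n : ℕ) (s : Term) (x : ℕ) (S : LStructure) (ρ : ℕ → Carrier S) →
          Fin n × Fin n → Set
θ-holds n s x S ρ (w , r) =
  D S n (_*_ S (pow S (2# S) (toℕ w)) (⟦ s ⟧ S ρ)) ×
  D S n (_*_ S (pow S (2# S) (toℕ r)) (ρ x))

⋁θ : (n : ℕ) (s : Term) (x : ℕ) (S : LStructure) (ρ : ℕ → Carrier S) →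
     List (Fin n × Fin n) → Set
⋁θ n s x S ρ θs = Any (θ-holds n s x S ρ) θs

{-# OPTIONS --safe #-}

-- Every x ∈ A is 2^k aⁿ with k < n and a ∈ A: for an n-th root z of x (real
-- closedness) and a = λ(z), the element (z/a)ⁿ of A lies in [1, 2ⁿ), and by the gap
-- axiom the only elements of A there are 2⁰, …, 2ⁿ⁻¹.  Dₙ is the group of n-th powers
-- of elements of A, so modulo Dₙ we have x ≡ 2^k, hence s xⁱ ≡ 2^(ik) s and
-- 2^(n∸k) x ≡ 1; conversely those two memberships give s xⁱ ∈ Dₙ for every k ≤ n.
-- Powers of 2 matter only modulo 2ⁿ ∈ Dₙ, which brings the exponents below n.

module Submission where

open import Algebra.Bundles using (CommutativeRing)
open import Algebra.Consequences.Propositional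
  using (comm∧idʳ⇒id; comm∧invˡ⇒inv; comm∧distrˡ⇒distrʳ)
import Algebra.Properties.Ring as RingProperties
import Algebra.Solver.Ring.NaturalCoefficients.Default as NaturalSolver
open import Data.Empty using (⊥-elim)
open import Data.Fin using (Fin; zero; suc; toℕ)
open import Data.Fin.Properties using (toℕ-fromℕ<; toℕ≤n)
open import Data.List using (List; tabulate)
open import Data.List.Relation.Unary.Any.Properties using (tabulate⁺; tabulate⁻)
open import Data.Nat as ℕ using (ℕ; zero; suc; NonZero; _≤_; _∸_)
open import Data.Nat.DivMod using (_%_; _div_; _mod_; m%n<n; m≡m%n+[m/n]*n)
open import Data.Nat.Induction using (<-wellFounded)
import Data.Nat.Properties as ℕₚ
open import Data.Product as Product using (Σ; ∃-syntax; _×_; _,_; map₂; uncurry)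
open import Data.Product.Function.NonDependent.Propositional using (_×-⇔_)
open import Data.Sum as Sum using (_⊎_; inj₁; inj₂)
open import Data.Vec using (Vec; []; _∷_)
open import Function.Base using (_∘_)
open import Function.Bundles using (_⇔_; mk⇔; Equivalence)
open import Function.Construct.Composition using (_⇔-∘_)
open import Induction.WellFounded using (Acc; acc)
open import Relation.Binary.PropositionalEquality
open import Relation.Nullary using (¬_)

open import Defs using (ModelT; struct; isT)

data Parity : ℕ → Set where
  even : ∀ h → Parity (h ℕ.* 2)
  odd  : ∀ k → Parity (suc (k ℕ.* 2))

parity : ∀ n → Parity n
parity zero = even zero
parity (suc n) with parity n
... | even h = odd h
... | odd k  = even (suc k)

module Properties (M : ModelT) where

  open Defs.LStructure (struct M)
  open Defs.Ops (struct M)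
  private module T = Defs.IsModelT (isT M)
  open ≡-Reasoning

  infix 8 -_
  -_ : Carrier → Carrier
  - x = 0# - x

  commutativeRing : CommutativeRing _ _
  commutativeRing = record
    { Carrier = Carrier ; _≈_ = _≡_ ; _+_ = _+_ ; _*_ = _*_ ; -_ = -_ ; 0# = 0# ; 1# = 1#
    ; isCommutativeRing = record
      { isRing = record
        { +-isAbelianGroup = record
          { isGroup = record
            { isMonoid = record
              { isSemigroup = record
                { isMagma = record { isEquivalence = isEquivalence ; ∙-cong = cong₂ _+_ }
                ; assoc = T.+-assoc }
              ; identity = comm∧idʳ⇒id T.+-comm T.+-idʳ }
            ; inverse = comm∧invˡ⇒inv T.+-comm (T.-‿def 0#)
            ; ⁻¹-cong = cong (λ y → - y) }
          ; comm = T.+-comm }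
        ; *-cong = cong₂ _*_
        ; *-assoc = T.*-assoc
        ; *-identity = comm∧idʳ⇒id T.*-comm T.*-idʳ
        ; distrib = T.distrib , comm∧distrˡ⇒distrʳ T.*-comm T.distrib }
      ; *-comm = T.*-comm } }

  open CommutativeRing commutativeRing
    using ( +-assoc; +-identityˡ; +-identityʳ; -‿inverseˡ; -‿inverseʳ
          ; *-assoc; *-comm; *-identityˡ; *-identityʳ; distribˡ; distribʳ; zeroˡ; zeroʳ
          ; ring; commutativeSemiring)
  open RingProperties ring using (-‿involutive; -‿distribˡ-*; -‿distribʳ-*)
  open NaturalSolver commutativeSemiring using (solve; _:=_; _:+_; _:*_)

  -x*-x≡x*x : ∀ x → - x * - x ≡ x * x
  -x*-x≡x*x x = begin
    - x * - x     ≡⟨ -‿distribʳ-* (- x) x ⟨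
    - (- x * x)   ≡⟨ cong (λ y → - y) (-‿distribˡ-* x x) ⟨
    - (- (x * x)) ≡⟨ -‿involutive (x * x) ⟩
    x * x         ∎

  <-asym : ∀ {x y} → x < y → ¬ y < x
  <-asym {x} {y} x<y y<x = T.<-irrefl x (T.<-trans x y x x<y y<x)

  <⇒≢ : ∀ {x y} → x < y → x ≢ y
  <⇒≢ {x} x<x refl = T.<-irrefl x x<x

  <-≤-trans : ∀ {x y z} → x < y → y ≤ᶠ z → x < z
  <-≤-trans {x} {y} {z} x<y (inj₁ y<z) = T.<-trans x y z x<y y<z
  <-≤-trans x<y (inj₂ refl) = x<y

  ≤-<-trans : ∀ {x y z} → x ≤ᶠ y → y < z → x < z
  ≤-<-trans {x} {y} {z} (inj₁ x<y) y<z = T.<-trans x y z x<y y<z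
  ≤-<-trans (inj₂ refl) y<z = y<z

  ≤-trans : ∀ {x y z} → x ≤ᶠ y → y ≤ᶠ z → x ≤ᶠ z
  ≤-trans x≤y (inj₁ y<z) = inj₁ (≤-<-trans x≤y y<z)
  ≤-trans x≤y (inj₂ refl) = x≤y

  x<y⇒0<y-x : ∀ {x y} → x < y → 0# < y + - x
  x<y⇒0<y-x {x} {y} x<y = subst (_< y + - x) (-‿inverseʳ x) (T.<-+ x y (- x) x<y)

  x<0⇒0<-x : ∀ {x} → x < 0# → 0# < - x
  x<0⇒0<-x {x} x<0 = subst (0# <_) (+-identityˡ (- x)) (x<y⇒0<y-x x<0)

  0<-x⇒x<0 : ∀ {x} → 0# < - x → x < 0#
  0<-x⇒x<0 {x} 0<-x = subst₂ _<_ (+-identityˡ x) (-‿inverseˡ x) (T.<-+ 0# (- x) x 0<-x)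

  *-monoˡ-< : ∀ {c x y} → 0# < c → x < y → c * x < c * y
  *-monoˡ-< {c} {x} {y} 0<c x<y =
    subst₂ _<_ (+-identityˡ (c * x)) c[y-x]+cx≡cy (T.<-+ 0# _ (c * x) (T.<-* c _ 0<c (x<y⇒0<y-x x<y)))
    where
    c[y-x]+cx≡cy : c * (y + - x) + c * x ≡ c * y
    c[y-x]+cx≡cy = begin
      c * (y + - x) + c * x ≡⟨ distribˡ c (y + - x) x ⟨
      c * ((y + - x) + x)   ≡⟨ cong (c *_) (+-assoc y (- x) x) ⟩
      c * (y + (- x + x))   ≡⟨ cong (λ z → c * (y + z)) (-‿inverseˡ x) ⟩
      c * (y + 0#)          ≡⟨ cong (c *_) (+-identityʳ y) ⟩
      c * y                 ∎

  *-monoʳ-< : ∀ {c x y} → 0# < c → x < y → x * c < y * c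
  *-monoʳ-< {c} {x} {y} 0<c x<y = subst₂ _<_ (*-comm c x) (*-comm c y) (*-monoˡ-< 0<c x<y)

  *-monoʳ-≤ : ∀ {c x y} → 0# < c → x ≤ᶠ y → x * c ≤ᶠ y * c
  *-monoʳ-≤ 0<c (inj₁ x<y) = inj₁ (*-monoʳ-< 0<c x<y)
  *-monoʳ-≤ 0<c (inj₂ refl) = inj₂ refl

  x<0⇒0<x*x : ∀ {x} → x < 0# → 0# < x * x
  x<0⇒0<x*x {x} x<0 = subst (0# <_) (-x*-x≡x*x x) (T.<-* _ _ (x<0⇒0<-x x<0) (x<0⇒0<-x x<0))

  x<0∧0<y⇒x*y<0 : ∀ {x y} → x < 0# → 0# < y → x * y < 0#
  x<0∧0<y⇒x*y<0 {x} {y} x<0 0<y =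
    0<-x⇒x<0 (subst (0# <_) (sym (-‿distribˡ-* x y)) (T.<-* _ _ (x<0⇒0<-x x<0) 0<y))

  0<1 : 0# < 1#
  0<1 with T.<-tri 0# 1#
  ... | inj₁ 0<1 = 0<1
  ... | inj₂ (inj₁ 0≡1) = ⊥-elim (T.0≢1 0≡1)
  ... | inj₂ (inj₂ 1<0) = ⊥-elim (<-asym 1<0 (subst (0# <_) (*-identityʳ 1#) (x<0⇒0<x*x 1<0)))

  1<2 : 1# < 2#
  1<2 = subst (_< 2#) (+-identityˡ 1#) (T.<-+ 0# 1# 1# 0<1)

  0<2 : 0# < 2#
  0<2 = T.<-trans 0# 1# 2# 0<1 1<2

  positive-inverse : ∀ {x} → 0# < x → ∃[ y ] x * y ≡ 1# × 0# < y
  positive-inverse {x} 0<x with T.inverse x (<⇒≢ 0<x ∘ sym)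
  ... | y , xy≡1 with T.<-tri 0# y
  ...   | inj₁ 0<y = y , xy≡1 , 0<y
  ...   | inj₂ (inj₁ refl) = ⊥-elim (T.0≢1 (trans (sym (zeroʳ x)) xy≡1))
  ...   | inj₂ (inj₂ y<0) =
          ⊥-elim (<-asym 0<1 (subst₂ _<_ xy≡1 (zeroʳ x) (*-monoˡ-< 0<x y<0)))

  pow-+ : ∀ x m n → pow x (m ℕ.+ n) ≡ pow x m * pow x n
  pow-+ x zero n = sym (*-identityˡ (pow x n))
  pow-+ x (suc m) n = trans (cong (x *_) (pow-+ x m n)) (sym (*-assoc x (pow x m) (pow x n)))

  pow-distrib-* : ∀ x y n → pow (x * y) n ≡ pow x n * pow y n
  pow-distrib-* x y zero = sym (*-identityˡ 1#)
  pow-distrib-* x y (suc n) = trans (cong ((x * y) *_) (pow-distrib-* x y n))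
    (solve 4 (λ x y p q → (x :* y) :* (p :* q) := (x :* p) :* (y :* q)) refl x y (pow x n) (pow y n))

  pow-* : ∀ x m n → pow x (m ℕ.* n) ≡ pow (pow x n) m
  pow-* x zero n = refl
  pow-* x (suc m) n = trans (pow-+ x n (m ℕ.* n)) (cong (pow x n *_) (pow-* x m n))

  pow-comm : ∀ x m n → pow (pow x m) n ≡ pow (pow x n) m
  pow-comm x m n = trans (sym (pow-* x n m)) (trans (cong (pow x) (ℕₚ.*-comm n m)) (pow-* x m n))

  pow-1# : ∀ n → pow 1# n ≡ 1#
  pow-1# zero = refl
  pow-1# (suc n) = trans (*-identityˡ (pow 1# n)) (pow-1# n)

  pow-pos : ∀ {x} n → 0# < x → 0# < pow x n
  pow-pos zero 0<x = 0<1
  pow-pos (suc n) 0<x = T.<-* _ _ 0<x (pow-pos n 0<x)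

  pow-mono-≤ : ∀ {x y} n → 0# < x → x ≤ᶠ y → pow x n ≤ᶠ pow y n
  pow-mono-≤ zero 0<x x≤y = inj₂ refl
  pow-mono-≤ {x} {y} (suc n) 0<x x≤y = ≤-trans
    (*-monoʳ-≤ (pow-pos n 0<x) x≤y)
    (subst₂ _≤ᶠ_ (*-comm (pow x n) y) (*-comm (pow y n) y)
      (*-monoʳ-≤ (<-≤-trans 0<x x≤y) (pow-mono-≤ n 0<x x≤y)))

  pow-mono-< : ∀ {x y} n → 0# < x → x < y → pow x (suc n) < pow y (suc n)
  pow-mono-< {x} {y} n 0<x x<y = <-≤-trans
    (*-monoʳ-< (pow-pos n 0<x) x<y)
    (subst₂ _≤ᶠ_ (*-comm (pow x n) y) (*-comm (pow y n) y)
      (*-monoʳ-≤ (T.<-trans 0# x y 0<x x<y) (pow-mono-≤ n 0<x (inj₁ x<y))))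

  lowerTerms : ∀ {d} → Vec Carrier d → Carrier → Carrier
  lowerTerms [] y = 0#
  lowerTerms {suc d} (a ∷ as) y = a * pow y d + lowerTerms as y

  -- The Horner accumulator of evalMonic is not accessible, so we induct by
  -- folding the two leading coefficients into one: the accumulator after
  -- reading a and b equals the accumulator after reading b′ alone.
  evalMonic-fold : ∀ {d} a b b′ (bs : Vec Carrier d) y →
    (pow y (suc (suc d)) + a * pow y (suc d)) + b * pow y d ≡ pow y (suc d) + b′ * pow y d →
    evalMonic (a ∷ b ∷ bs) y ≡ evalMonic (b′ ∷ bs) y
  evalMonic-fold a b b′ bs y folded rewrite folded = refl

  evalMonic≡pow+lowerTerms : ∀ {d} (as : Vec Carrier d) y → evalMonic as y ≡ pow y d + lowerTerms as y
  evalMonic≡pow+lowerTerms [] y = sym (+-identityʳ 1#)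
  evalMonic≡pow+lowerTerms (a ∷ []) y = cong (pow y 1 +_) (sym (+-identityʳ (a * 1#)))
  evalMonic≡pow+lowerTerms {suc (suc d)} (a ∷ b ∷ bs) y = begin
    evalMonic (a ∷ b ∷ bs) y                       ≡⟨ evalMonic-fold a b b′ bs y folded ⟩
    evalMonic (b′ ∷ bs) y                          ≡⟨ evalMonic≡pow+lowerTerms (b′ ∷ bs) y ⟩
    pow y (suc d) + (b′ * pow y d + lowerTerms bs y) ≡⟨ +-assoc (pow y (suc d)) _ _ ⟨
    (pow y (suc d) + b′ * pow y d) + lowerTerms bs y ≡⟨ cong (_+ lowerTerms bs y) folded ⟨
    ((y * Y + a * Y) + b * pow y d) + lowerTerms bs y
      ≡⟨ solve 4 (λ Y aY bP L → ((Y :+ aY) :+ bP) :+ L := Y :+ (aY :+ (bP :+ L))) refl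
           (y * Y) (a * Y) (b * pow y d) (lowerTerms bs y) ⟩
    pow y (suc (suc d)) + lowerTerms (a ∷ b ∷ bs) y ∎
    where
    Y = pow y (suc d)
    b′ = ((y * y + a * y) + b) - y
    folded : (y * Y + a * Y) + b * pow y d ≡ Y + b′ * pow y d
    folded = begin
      (y * Y + a * Y) + b * pow y d
        ≡⟨ solve 4 (λ y P a b → (y :* (y :* P) :+ a :* (y :* P)) :+ b :* P
                                := ((y :* y :+ a :* y) :+ b) :* P) refl y (pow y d) a b ⟩
      ((y * y + a * y) + b) * pow y d     ≡⟨ cong (_* pow y d) (T.-‿def _ y) ⟨
      (b′ + y) * pow y d                  ≡⟨ distribʳ (pow y d) b′ y ⟩
      b′ * pow y d + Y                    ≡⟨ T.+-comm _ Y ⟩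
      Y + b′ * pow y d                    ∎

  constantCoefficients : Carrier → ∀ j → Vec Carrier (suc j)
  constantCoefficients c zero = c ∷ []
  constantCoefficients c (suc j) = 0# ∷ constantCoefficients c j

  evalMonic-constantCoefficients : ∀ c j y → evalMonic (constantCoefficients c j) y ≡ pow y (suc j) + c
  evalMonic-constantCoefficients c j y =
    trans (evalMonic≡pow+lowerTerms (constantCoefficients c j) y)
          (cong (pow y (suc j) +_) (lowerTerms≡c j))
    where
    lowerTerms≡c : ∀ j → lowerTerms (constantCoefficients c j) y ≡ c
    lowerTerms≡c zero = trans (+-identityʳ (c * 1#)) (*-identityʳ c)
    lowerTerms≡c (suc j) = trans (cong₂ _+_ (zeroˡ (pow y (suc j))) (lowerTerms≡c j)) (+-identityˡ c)

  odd-root : ∀ k {x} → 0# < x → ∃[ z ] 0# < z × pow z (suc (k ℕ.* 2)) ≡ x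
  odd-root k {x} 0<x with T.oddRoot k (constantCoefficients (- x) (k ℕ.* 2))
  ... | y , isRoot = positive (T.<-tri y 0#)
    where
    m = suc (k ℕ.* 2)
    y^m≡x : pow y m ≡ x
    y^m≡x = begin
      pow y m                              ≡⟨ +-identityʳ (pow y m) ⟨
      pow y m + 0#                         ≡⟨ cong (pow y m +_) (-‿inverseˡ x) ⟨
      pow y m + (- x + x)                  ≡⟨ +-assoc (pow y m) (- x) x ⟨
      (pow y m + - x) + x                  ≡⟨ cong (_+ x) (evalMonic-constantCoefficients (- x) (k ℕ.* 2) y) ⟨
      evalMonic (constantCoefficients (- x) (k ℕ.* 2)) y + x ≡⟨ cong (_+ x) isRoot ⟩
      0# + x                               ≡⟨ +-identityˡ x ⟩
      x                                    ∎
    positive : y < 0# ⊎ y ≡ 0# ⊎ 0# < y → ∃[ z ] 0# < z × pow z m ≡ x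
    positive (inj₁ y<0) = ⊥-elim (<-asym 0<x (subst (_< 0#) y^m≡x (x<0∧0<y⇒x*y<0 y<0 0<y^2k)))
      where
      0<y^2k : 0# < pow y (k ℕ.* 2)
      0<y^2k = subst (0# <_) (sym (pow-* y k 2))
                 (pow-pos k (subst (0# <_) (cong (y *_) (sym (*-identityʳ y))) (x<0⇒0<x*x y<0)))
    positive (inj₂ (inj₁ refl)) = ⊥-elim (<⇒≢ 0<x (trans (sym (zeroˡ _)) y^m≡x))
    positive (inj₂ (inj₂ 0<y)) = y , 0<y , y^m≡x

  square-root : ∀ {x} → 0# < x → ∃[ z ] 0# < z × z * z ≡ x
  square-root {x} 0<x with T.sqrt x 0<x
  ... | y , y*y≡x with T.<-tri y 0#
  ...   | inj₁ y<0 = - y , x<0⇒0<-x y<0 , trans (-x*-x≡x*x y) y*y≡x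
  ...   | inj₂ (inj₁ refl) = ⊥-elim (<⇒≢ 0<x (trans (sym (zeroˡ 0#)) y*y≡x))
  ...   | inj₂ (inj₂ 0<y) = y , 0<y , y*y≡x

  -- A root of degree 2^e (2k+1) is an odd root followed by e square roots.
  root-of-degree-suc : ∀ {m} → Acc ℕ._<_ m → ∀ {x} → 0# < x → ∃[ z ] 0# < z × pow z (suc m) ≡ x
  root-of-degree-suc {m} (acc smaller) {x} 0<x with parity m
  ... | even k = odd-root k 0<x
  ... | odd h = square-root-of (root-of-degree-suc (smaller h<m) 0<x)
    where
    h<m : h ℕ.< suc (h ℕ.* 2)
    h<m = ℕ.s≤s (ℕₚ.m≤m*n h 2)
    square-root-of : ∃[ w ] 0# < w × pow w (suc h) ≡ x → ∃[ z ] 0# < z × pow z (suc h ℕ.* 2) ≡ x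
    square-root-of (w , 0<w , w^h≡x) with square-root 0<w
    ... | z , 0<z , z*z≡w = z , 0<z , (begin
      pow z (suc h ℕ.* 2)     ≡⟨ pow-* z (suc h) 2 ⟩
      pow (z * (z * 1#)) (suc h) ≡⟨ cong (λ t → pow (z * t) (suc h)) (*-identityʳ z) ⟩
      pow (z * z) (suc h)     ≡⟨ cong (λ t → pow t (suc h)) z*z≡w ⟩
      pow w (suc h)           ≡⟨ w^h≡x ⟩
      x                       ∎)

  positive-root : ∀ n .{{_ : NonZero n}} {x} → 0# < x → ∃[ z ] 0# < z × pow z n ≡ x
  positive-root (suc m) = root-of-degree-suc (<-wellFounded m)

  A-1 : A 1#
  A-1 = Equivalence.from (T.A-mul 2# 1# T.A-2) (subst A (sym (*-identityʳ 2#)) T.A-2)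

  A-* : ∀ {x y} → A x → A y → A (x * y)
  A-* {x} {y} x∈A = Equivalence.to (T.A-mul x y x∈A)

  A-inverse : ∀ {x y} → A x → x * y ≡ 1# → A y
  A-inverse {x} {y} x∈A xy≡1 = Equivalence.from (T.A-mul x y x∈A) (subst A (sym xy≡1) A-1)

  A-pow : ∀ n {x} → A x → A (pow x n)
  A-pow zero x∈A = A-1
  A-pow (suc n) x∈A = A-* x∈A (A-pow n x∈A)

  halve : ∀ m {u} → A u → 2# ≤ᶠ u → u < pow 2# (suc m) →
          ∃[ v ] A v × 1# ≤ᶠ v × v < pow 2# m × u ≡ 2# * v
  halve m {u} u∈A 2≤u u<2^[m+1] with positive-inverse 0<2
  ... | h , 2h≡1 , 0<h =
    u * h ,
    A-* u∈A (A-inverse T.A-2 2h≡1) ,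
    subst (_≤ᶠ u * h) 2h≡1 (*-monoʳ-≤ 0<h 2≤u) ,
    subst (u * h <_) [2*2^m]*h≡2^m (*-monoʳ-< 0<h u<2^[m+1]) ,
    sym (trans (solve 3 (λ u h t → t :* (u :* h) := u :* (t :* h)) refl u h 2#)
               (trans (cong (u *_) 2h≡1) (*-identityʳ u)))
    where
    [2*2^m]*h≡2^m : (2# * pow 2# m) * h ≡ pow 2# m
    [2*2^m]*h≡2^m = trans (solve 3 (λ t p h → (t :* p) :* h := p :* (t :* h)) refl 2# (pow 2# m) h)
                          (trans (cong (pow 2# m *_) 2h≡1) (*-identityʳ (pow 2# m)))

  A∧1≤u<2^m⇒u≡2^k : ∀ m {u} → A u → 1# ≤ᶠ u → u < pow 2# m → ∃[ k ] u ≡ pow 2# (toℕ {m} k)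
  A∧1≤u<2^m⇒u≡2^k zero u∈A 1≤u u<1 = ⊥-elim (T.<-irrefl 1# (≤-<-trans 1≤u u<1))
  A∧1≤u<2^m⇒u≡2^k (suc m) {u} u∈A 1≤u u<2^[m+1] with T.<-tri u 2#
  ... | inj₁ u<2 = zero , u≡1 1≤u
    where
    u≡1 : 1# ≤ᶠ u → u ≡ 1#
    u≡1 (inj₁ 1<u) = ⊥-elim (T.A-gap u 1<u u<2 u∈A)
    u≡1 (inj₂ 1≡u) = sym 1≡u
  ... | inj₂ u≥2 = double (halve m u∈A (Sum.map₂ sym (Sum.swap u≥2)) u<2^[m+1])
    where
    double : ∃[ v ] A v × 1# ≤ᶠ v × v < pow 2# m × u ≡ 2# * v → ∃[ k ] u ≡ pow 2# (toℕ {suc m} k)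
    double (v , v∈A , 1≤v , v<2^m , u≡2v) =
      Product.map suc (trans u≡2v ∘ cong (2# *_)) (A∧1≤u<2^m⇒u≡2^k m v∈A 1≤v v<2^m)

  λ-factor : ∀ {z} → 0# < z → ∃[ a ] A a × ∃[ t ] 1# ≤ᶠ t × t < 2# × a * t ≡ z
  λ-factor {z} 0<z =
    let a∈A , a≤z , z<2a = T.lam-pos z 0<z
        a = lam z
        a⁻¹ , aa⁻¹≡1 , 0<a⁻¹ = positive-inverse (T.A-pos a a∈A)
    in a , a∈A , z * a⁻¹ ,
       subst (_≤ᶠ z * a⁻¹) aa⁻¹≡1 (*-monoʳ-≤ 0<a⁻¹ a≤z) ,
       subst (z * a⁻¹ <_) (trans (*-assoc 2# a a⁻¹) (trans (cong (2# *_) aa⁻¹≡1) (*-identityʳ 2#)))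
         (*-monoʳ-< 0<a⁻¹ z<2a) ,
       trans (solve 3 (λ a z b → a :* (z :* b) := z :* (a :* b)) refl a z a⁻¹)
             (trans (cong (z *_) aa⁻¹≡1) (*-identityʳ z))

  A-decomposition : ∀ n .{{_ : NonZero n}} {x} → A x →
                    ∃[ k ] ∃[ a ] A a × x ≡ pow 2# (toℕ {n} k) * pow a n
  A-decomposition n@(suc n′) {x} x∈A =
    let z , 0<z , z^n≡x = positive-root n (T.A-pos x x∈A)
        a , a∈A , t , 1≤t , t<2 , at≡z = λ-factor 0<z
        a^n*t^n≡x = trans (sym (pow-distrib-* a t n)) (trans (cong (λ w → pow w n) at≡z) z^n≡x)
        t^n∈A = Equivalence.from (T.A-mul _ _ (A-pow n a∈A)) (subst A (sym a^n*t^n≡x) x∈A)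
        1≤t^n = subst (_≤ᶠ pow t n) (pow-1# n) (pow-mono-≤ n 0<1 1≤t)
        t^n<2^n = pow-mono-< n′ (<-≤-trans 0<1 1≤t) t<2
        k , t^n≡2^k = A∧1≤u<2^m⇒u≡2^k n t^n∈A 1≤t^n t^n<2^n
    in k , a , a∈A , (begin
      x                   ≡⟨ a^n*t^n≡x ⟨
      pow a n * pow t n   ≡⟨ *-comm (pow a n) (pow t n) ⟩
      pow t n * pow a n   ≡⟨ cong (_* pow a n) t^n≡2^k ⟩
      pow 2# (toℕ k) * pow a n ∎)

  IsPow : ℕ → Carrier → Set
  IsPow n y = ∃[ b ] A b × pow b n ≡ y

  IsPow-* : ∀ n {u v} → IsPow n u → IsPow n v → IsPow n (u * v)
  IsPow-* n (b , b∈A , bⁿ≡u) (c , c∈A , cⁿ≡v) =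
    b * c , A-* b∈A c∈A , trans (pow-distrib-* b c n) (cong₂ _*_ bⁿ≡u cⁿ≡v)

  IsPow-pow : ∀ n i {u} → IsPow n u → IsPow n (pow u i)
  IsPow-pow n i (b , b∈A , bⁿ≡u) =
    pow b i , A-pow i b∈A , trans (pow-comm b i n) (cong (λ w → pow w i) bⁿ≡u)

  IsPow-cancel : ∀ n {u b} → A b → IsPow n (u * pow b n) → IsPow n u
  IsPow-cancel n {u} {b} b∈A (c , c∈A , cⁿ≡ubⁿ) =
    let b⁻¹ , bb⁻¹≡1 , _ = positive-inverse (T.A-pos b b∈A)
    in c * b⁻¹ , A-* c∈A (A-inverse b∈A bb⁻¹≡1) , (begin
      pow (c * b⁻¹) n            ≡⟨ pow-distrib-* c b⁻¹ n ⟩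
      pow c n * pow b⁻¹ n        ≡⟨ cong (_* pow b⁻¹ n) cⁿ≡ubⁿ ⟩
      (u * pow b n) * pow b⁻¹ n  ≡⟨ *-assoc u (pow b n) (pow b⁻¹ n) ⟩
      u * (pow b n * pow b⁻¹ n)  ≡⟨ cong (u *_) (pow-distrib-* b b⁻¹ n) ⟨
      u * pow (b * b⁻¹) n        ≡⟨ cong (λ w → u * pow w n) bb⁻¹≡1 ⟩
      u * pow 1# n               ≡⟨ cong (u *_) (pow-1# n) ⟩
      u * 1#                     ≡⟨ *-identityʳ u ⟩
      u                          ∎)

  IsPow-2^%⇔ : ∀ n .{{_ : NonZero n}} m u → IsPow n (pow 2# (m % n) * u) ⇔ IsPow n (pow 2# m * u)
  IsPow-2^%⇔ n m u = mk⇔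
    (λ p → subst (IsPow n) (sym split) (IsPow-* n p (pow 2# q , A-pow q T.A-2 , refl)))
    (IsPow-cancel n (A-pow q T.A-2) ∘ subst (IsPow n) split)
    where
    q = m div n
    split : pow 2# m * u ≡ (pow 2# (m % n) * u) * pow (pow 2# q) n
    split = begin
      pow 2# m * u                             ≡⟨ cong (λ e → pow 2# e * u) (m≡m%n+[m/n]*n m n) ⟩
      pow 2# (m % n ℕ.+ q ℕ.* n) * u           ≡⟨ cong (_* u) (pow-+ 2# (m % n) (q ℕ.* n)) ⟩
      (pow 2# (m % n) * pow 2# (q ℕ.* n)) * u  ≡⟨ cong (λ w → (pow 2# (m % n) * w) * u)
                                                       (trans (pow-* 2# q n) (pow-comm 2# n q)) ⟩
      (pow 2# (m % n) * pow (pow 2# q) n) * u  ≡⟨ solve 3 (λ r Q u → (r :* Q) :* u := (r :* u) :* Q)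
                                                       refl (pow 2# (m % n)) (pow (pow 2# q) n) u ⟩
      (pow 2# (m % n) * u) * pow (pow 2# q) n  ∎

  2^[n∸k]*2^k≡2^n : ∀ {n k} → k ℕ.≤ n → pow 2# (n ∸ k) * pow 2# k ≡ pow 2# n
  2^[n∸k]*2^k≡2^n {n} {k} k≤n = trans (sym (pow-+ 2# (n ∸ k) k)) (cong (pow 2#) (ℕₚ.m∸n+n≡m k≤n))

  IsPow-*pow⇔ : ∀ n .{{_ : NonZero n}} i σ {x} → A x →
    IsPow n (σ * pow x i) ⇔
    (∃[ k ] IsPow n (pow 2# (i ℕ.* toℕ {n} k) * σ) × IsPow n (pow 2# (n ∸ toℕ k) * x))
  IsPow-*pow⇔ n i σ {x} x∈A = mk⇔ forward backward
    where
    split : ∀ k a → x ≡ pow 2# k * pow a n → σ * pow x i ≡ (pow 2# (i ℕ.* k) * σ) * pow (pow a i) n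
    split k a x≡2ᵏaⁿ = begin
      σ * pow x i                               ≡⟨ cong (λ w → σ * pow w i) x≡2ᵏaⁿ ⟩
      σ * pow (pow 2# k * pow a n) i            ≡⟨ cong (σ *_) (pow-distrib-* (pow 2# k) (pow a n) i) ⟩
      σ * (pow (pow 2# k) i * pow (pow a n) i)  ≡⟨ cong₂ (λ p q → σ * (p * q))
                                                      (sym (pow-* 2# i k)) (pow-comm a n i) ⟩
      σ * (pow 2# (i ℕ.* k) * pow (pow a i) n)  ≡⟨ solve 3 (λ s p q → s :* (p :* q) := (p :* s) :* q)
                                                      refl σ (pow 2# (i ℕ.* k)) (pow (pow a i) n) ⟩
      (pow 2# (i ℕ.* k) * σ) * pow (pow a i) n  ∎

    complete : ∀ k a → k ℕ.≤ n → x ≡ pow 2# k * pow a n → pow (2# * a) n ≡ pow 2# (n ∸ k) * x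
    complete k a k≤n x≡2ᵏaⁿ = begin
      pow (2# * a) n                         ≡⟨ pow-distrib-* 2# a n ⟩
      pow 2# n * pow a n                     ≡⟨ cong (_* pow a n) (2^[n∸k]*2^k≡2^n k≤n) ⟨
      (pow 2# (n ∸ k) * pow 2# k) * pow a n  ≡⟨ *-assoc (pow 2# (n ∸ k)) (pow 2# k) (pow a n) ⟩
      pow 2# (n ∸ k) * (pow 2# k * pow a n)  ≡⟨ cong (pow 2# (n ∸ k) *_) x≡2ᵏaⁿ ⟨
      pow 2# (n ∸ k) * x                     ∎

    recombine : ∀ k → k ℕ.≤ n →
      (pow 2# (i ℕ.* k) * σ) * pow (pow 2# (n ∸ k) * x) i ≡ (σ * pow x i) * pow (pow 2# i) n
    recombine k k≤n = begin
      (pow 2# (i ℕ.* k) * σ) * pow (2ⁿ⁻ᵏ * x) i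
        ≡⟨ cong (λ p → (p * σ) * pow (2ⁿ⁻ᵏ * x) i) (pow-* 2# i k) ⟩
      (pow (pow 2# k) i * σ) * pow (2ⁿ⁻ᵏ * x) i
        ≡⟨ solve 3 (λ p s q → (p :* s) :* q := s :* (q :* p))
                   refl (pow (pow 2# k) i) σ (pow (2ⁿ⁻ᵏ * x) i) ⟩
      σ * (pow (2ⁿ⁻ᵏ * x) i * pow (pow 2# k) i)
        ≡⟨ cong (σ *_) (pow-distrib-* (2ⁿ⁻ᵏ * x) (pow 2# k) i) ⟨
      σ * pow ((2ⁿ⁻ᵏ * x) * pow 2# k) i
        ≡⟨ cong (λ w → σ * pow w i) 2ⁿ⁻ᵏx2ᵏ≡2ⁿx ⟩
      σ * pow (pow 2# n * x) i
        ≡⟨ cong (σ *_) (pow-distrib-* (pow 2# n) x i) ⟩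
      σ * (pow (pow 2# n) i * pow x i)
        ≡⟨ cong (λ w → σ * (w * pow x i)) (pow-comm 2# n i) ⟩
      σ * (pow (pow 2# i) n * pow x i)
        ≡⟨ solve 3 (λ s P X → s :* (P :* X) := (s :* X) :* P) refl σ (pow (pow 2# i) n) (pow x i) ⟩
      (σ * pow x i) * pow (pow 2# i) n
        ∎
      where
      2ⁿ⁻ᵏ = pow 2# (n ∸ k)
      2ⁿ⁻ᵏx2ᵏ≡2ⁿx : (2ⁿ⁻ᵏ * x) * pow 2# k ≡ pow 2# n * x
      2ⁿ⁻ᵏx2ᵏ≡2ⁿx = trans (solve 3 (λ p x q → (p :* x) :* q := (p :* q) :* x) refl 2ⁿ⁻ᵏ x (pow 2# k))
                          (cong (_* x) (2^[n∸k]*2^k≡2^n k≤n))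

    forward : IsPow n (σ * pow x i) →
              ∃[ k ] IsPow n (pow 2# (i ℕ.* toℕ {n} k) * σ) × IsPow n (pow 2# (n ∸ toℕ k) * x)
    forward σxⁱ∈Pₙ =
      let k , a , a∈A , x≡2ᵏaⁿ = A-decomposition n x∈A
      in k ,
         IsPow-cancel n (A-pow i a∈A) (subst (IsPow n) (split (toℕ k) a x≡2ᵏaⁿ) σxⁱ∈Pₙ) ,
         (2# * a , A-* T.A-2 a∈A , complete (toℕ k) a (toℕ≤n k) x≡2ᵏaⁿ)

    backward : ∃[ k ] IsPow n (pow 2# (i ℕ.* toℕ {n} k) * σ) × IsPow n (pow 2# (n ∸ toℕ k) * x) →
               IsPow n (σ * pow x i)
    backward (k , 2^ikσ∈Pₙ , 2^[n∸k]x∈Pₙ) =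
      IsPow-cancel n (A-pow i T.A-2)
        (subst (IsPow n) (recombine (toℕ k) (toℕ≤n k))
          (IsPow-* n 2^ikσ∈Pₙ (IsPow-pow n i 2^[n∸k]x∈Pₙ)))

  D⇔IsPow : ∀ n .{{_ : NonZero n}} y → D n y ⇔ IsPow n y
  D⇔IsPow n = T.D-def n (ℕ.>-nonZero⁻¹ n)

  D-2^mod⇔ : ∀ n .{{_ : NonZero n}} m u → D n (pow 2# (toℕ (m mod n)) * u) ⇔ IsPow n (pow 2# m * u)
  D-2^mod⇔ n m u =
    subst (λ e → D n (pow 2# e * u) ⇔ IsPow n (pow 2# m * u)) (sym (toℕ-fromℕ< (m%n<n m n)))
      (IsPow-2^%⇔ n m u ⇔-∘ D⇔IsPow n (pow 2# (m % n) * u))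

  D-*pow⇔ : ∀ n .{{_ : NonZero n}} i σ {x} → A x →
    D n (σ * pow x i) ⇔
    (∃[ k ] D n (pow 2# (toℕ ((i ℕ.* toℕ {n} k) mod n)) * σ) ×
            D n (pow 2# (toℕ ((n ∸ toℕ k) mod n)) * x))
  D-*pow⇔ n i σ {x} x∈A =
    mk⇔ (map₂ (Equivalence.from (both _))) (map₂ (Equivalence.to (both _)))
      ⇔-∘ (IsPow-*pow⇔ n i σ x∈A ⇔-∘ D⇔IsPow n (σ * pow x i))
    where
    both : ∀ k →
      (D n (pow 2# (toℕ ((i ℕ.* toℕ {n} k) mod n)) * σ) ×
       D n (pow 2# (toℕ ((n ∸ toℕ k) mod n)) * x)) ⇔
      (IsPow n (pow 2# (i ℕ.* toℕ k) * σ) × IsPow n (pow 2# (n ∸ toℕ k) * x))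
    both k = D-2^mod⇔ n (i ℕ.* toℕ k) σ ×-⇔ D-2^mod⇔ n (n ∸ toℕ k) x

open Defs

lemma3p16 : (x : ℕ) (s : Term) → x ∉ₜ s → (n i : ℕ) → 1 ≤ n →
    Σ (List (Fin n × Fin n)) λ θs →
    (M : ModelT) (ρ : ℕ → Carrier (struct M)) → A (struct M) (ρ x) →
    (D (struct M) n (_*_ (struct M) (⟦ s ⟧ (struct M) ρ) (pow (struct M) (ρ x) i))
    ⇔ ⋁θ n s x (struct M) ρ θs)
-- The equivalence holds for every value of s, whether or not it depends on x,
-- so the hypothesis x ∉ₜ s is not needed.
lemma3p16 x s _ n i 1≤n = tabulate θ , λ M ρ x∈A →
  mk⇔ (uncurry tabulate⁺) tabulate⁻ ⇔-∘ Properties.D-*pow⇔ M n i (⟦ s ⟧ (struct M) ρ) x∈A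
  where
  instance
    n≢0 : NonZero n
    n≢0 = ℕ.>-nonZero 1≤n
  θ : Fin n → Fin n × Fin n
  θ k = (i ℕ.* toℕ k) mod n , (n ∸ toℕ k) mod n
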